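{- For every $n \geq 1$, the $h$-polynomial of $(\mathsf{Tr}(n),\preccurlyeq)$ is $$\sum_{u \in \mathsf{Tr}(n)} y^{\mathrm{out}(u)} = (y+1)^{n-2}\left(y^2 + (n+1)y + 1\right),$$ where $\mathrm{out}(u)$ is the number of elements of $\mathsf{Tr}(n)$ covering $u$ (for $n=1$ the right-hand side is understood as the polynomial $(y+1)^{ -1}(y+1)^2 = y+1$).
   Context: For $n\ge1$, $\mathsf{Tr}(n)$ is the set of words $u = u_1\cdots u_n$ over $\{0,1,2\}$ with $u_1 \neq 2$ and no indices $i<j$ with $u_i=0$, $u_j=1$, ordered componentwise ($u\preccurlyeq v$ iff $u_i\le v_i$ for all $i$). -}

module Defs where

open import Data.Nat using (ℕ; zero; suc; _+_; _*_; _^_)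
open import Data.Fin using (Fin; zero; suc) renaming (_≤_ to _≤ᶠ_; _<_ to _<ᶠ_)
import Data.Fin as F
import Data.Fin.Properties as FP
open import Data.Vec using (Vec; []; _∷_; lookup)
import Data.Vec.Properties as VP
open import Data.List using (List; []; _∷_; map; concatMap; filter; length; allFin)
open import Data.Nat.ListAction using (sum)
open import Data.List.Relation.Unary.Any using (Any; any?)
open import Data.Product using (_×_)
open import Data.Empty using (⊥)
open import Relation.Binary.PropositionalEquality using (_≡_; _≢_)
open import Relation.Nullary using (Dec; ¬_; ¬?; _×-dec_; _→-dec_)

Word : ℕ → Set
Word n = Vec (Fin 3) n

allWords : (n : ℕ) → List (Word n)
allWords zero = [] ∷ []
allWords (suc n) = concatMap (λ a → map (a ∷_) (allWords n)) (allFin 3)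

IsTr : {n : ℕ} → Word (suc n) → Set
IsTr {n} u = (lookup u zero ≢ F.fromℕ 2)
  × (∀ (i j : Fin (suc n)) → i <ᶠ j → lookup u i ≡ zero → lookup u j ≡ suc zero → ⊥)

isTr? : {n : ℕ} → (u : Word (suc n)) → Dec (IsTr u)
isTr? {n} u =
  ¬? (lookup u zero FP.≟ F.fromℕ 2) ×-dec
  FP.all? (λ i → FP.all? (λ j →
    (i FP.<? j) →-dec ((lookup u i FP.≟ zero) →-dec
      ((lookup u j FP.≟ suc zero) →-dec (no (λ ())) ))))
  where open import Relation.Nullary using (no)

-- The set Tr(n) (n ≥ 1, written suc n), as a duplicate-free list.
Tr : (n : ℕ) → List (Word (suc n))
Tr n = filter isTr? (allWords (suc n))

_≼_ : {n : ℕ} → Word n → Word n → Set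
u ≼ v = ∀ i → lookup u i ≤ᶠ lookup v i

_≺_ : {n : ℕ} → Word n → Word n → Set
u ≺ v = (u ≼ v) × (u ≢ v)

_≼?_ : {n : ℕ} → (u v : Word n) → Dec (u ≼ v)
u ≼? v = FP.all? (λ i → lookup u i FP.≤? lookup v i)

_≺?_ : {n : ℕ} → (u v : Word n) → Dec (u ≺ v)
u ≺? v = (u ≼? v) ×-dec ¬? (VP.≡-dec FP._≟_ u v)

Covers : (n : ℕ) → Word (suc n) → Word (suc n) → Set
Covers n u v = (u ≺ v) × ¬ Any (λ w → (u ≺ w) × (w ≺ v)) (Tr n)

covers? : (n : ℕ) → (u v : Word (suc n)) → Dec (Covers n u v)
covers? n u v = (u ≺? v) ×-dec ¬? (any? (λ w → (u ≺? w) ×-dec (w ≺? v)) (Tr n))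

out : (n : ℕ) → Word (suc n) → ℕ
out n u = length (filter (covers? n u) (Tr n))

hPoly : (n : ℕ) → ℕ → ℕ
hPoly n y = sum (map (λ u → y ^ out n u) (Tr n))

-- Right-hand side (y+1)^{m-2} (y² + (m+1) y + 1) for m = suc n ≥ 1,
-- with the m = 1 case read as (y+1)^{-1}(y+1)^2 = y + 1.
rhs : (n : ℕ) → ℕ → ℕ
rhs zero y = y + 1
rhs (suc k) y = (y + 1) ^ k * (y * y + (suc (suc k) + 1) * y + 1)

-- Read a word of Tr(n) left to right with a three-state automaton: the first letter may not be 2,
-- and once a 0 has been read the letter 1 is forbidden. Covers are local: v covers u exactly when v
-- arises from u by raising a single letter to the next letter admitted in the state in which it is
-- read, because raising a letter only enlarges the set of admissible continuations. So out(u) is the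
-- number of 0s of u plus the number of its 1s after the first position. Summing y^out over the words
-- of length m accepted from each state gives polynomials with H_after(m) = (y+1)^m,
-- H_before(m+1) = y H_after(m) + (y+1) H_before(m) and H_initial(m+1) = y H_after(m) + H_before(m),
-- which solve to the stated closed form.
module Submission where

open import Defs
open import Data.Nat using (ℕ)
open import Relation.Binary.PropositionalEquality using (_≡_)

open import Data.Bool using (Bool; true; false; T; T?; if_then_else_; _∧_)
open import Data.Bool.Properties using (T-∧)
open import Data.Empty using (⊥)
open import Data.Fin using (Fin; zero; suc) renaming (_≤_ to _≤ᶠ_; _<_ to _<ᶠ_)
import Data.Fin.Properties as Fin
open import Data.List using (List; []; _∷_; _++_; map; filter; length; concatMap; allFin)
open import Data.List.Membership.Propositional using (_∈_; find; lose)
open import Data.List.Membership.Propositional.Properties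
  using (∈-filter⁺; ∈-filter⁻; ∈-concatMap⁺; ∈-map⁺; ∈-allFin)
open import Data.List.Properties using (map-cong; map-++; map-∘)
open import Data.List.Relation.Unary.Any using (Any; here)
open import Data.Maybe using (Maybe; just; nothing; is-just)
import Data.Maybe.Properties as Maybe
open import Data.Nat using (zero; suc; _+_; _*_; _^_; z≤n; s≤s)
open import Data.Nat.ListAction using (sum)
open import Data.Nat.ListAction.Properties using (sum-++)
import Data.Nat.Properties as ℕ
open import Data.Nat.Tactic.RingSolver using (solve-∀)
open import Data.Product using (_×_; _,_; proj₁; proj₂; ∃-syntax)
open import Data.Sum using (_⊎_; inj₁; inj₂; [_,_]′; fromInj₁)
import Data.Sum as Sum
open import Data.Unit using (tt)
open import Data.Vec using ([]; _∷_; lookup)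
import Data.Vec.Properties as Vec
open import Function using (_∘_; _⇔_; mk⇔; Equivalence)
open import Relation.Binary.Definitions using (DecidableEquality)
open import Relation.Binary.PropositionalEquality using (refl; sym; trans; cong; cong₂; _≢_; module ≡-Reasoning)
open import Relation.Nullary using (Dec; yes; no; does; contradiction; _×-dec_)
open import Relation.Nullary.Decidable using (does-⇔)
open import Relation.Unary using (Decidable)

open ≡-Reasoning

pattern one = suc zero
pattern two = suc (suc zero)

𝟙 : Bool → ℕ
𝟙 b = if b then 1 else 0

if-𝟙 : ∀ b c → (if b then 𝟙 c else 0) ≡ 𝟙 (b ∧ c)
if-𝟙 true  c = refl
if-𝟙 false c = refl

if-T-cong : ∀ b {x z : ℕ} → (T b → x ≡ z) → (if b then x else 0) ≡ (if b then z else 0)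
if-T-cong true  x≡z = x≡z tt
if-T-cong false x≡z = refl

if-*ˡ : ∀ b k x → (if b then k * x else 0) ≡ k * (if b then x else 0)
if-*ˡ true  k x = refl
if-*ˡ false k x = sym (ℕ.*-zeroʳ k)

does-sound : ∀ {A : Set} (A? : Dec A) → T (does A?) → A
does-sound (yes a) _ = a

does-complete : ∀ {A : Set} (A? : Dec A) → A → T (does A?)
does-complete (yes _) _ = tt
does-complete (no ¬a) a = ¬a a

module _ {A : Set} where

  sum-map-cong : ∀ {f g : A → ℕ} → (∀ x → f x ≡ g x) → ∀ xs → sum (map f xs) ≡ sum (map g xs)
  sum-map-cong f≗g xs = cong sum (map-cong f≗g xs)

  sum-map-zero : ∀ (xs : List A) → sum (map (λ _ → 0) xs) ≡ 0
  sum-map-zero []       = refl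
  sum-map-zero (_ ∷ xs) = sum-map-zero xs

  sum-map-*ˡ : ∀ k (f : A → ℕ) xs → sum (map (λ x → k * f x) xs) ≡ k * sum (map f xs)
  sum-map-*ˡ k f []       = sym (ℕ.*-zeroʳ k)
  sum-map-*ˡ k f (x ∷ xs) = begin
    k * f x + sum (map (λ x → k * f x) xs) ≡⟨ cong (k * f x +_) (sum-map-*ˡ k f xs) ⟩
    k * f x + k * sum (map f xs)            ≡⟨ ℕ.*-distribˡ-+ k (f x) _ ⟨
    k * (f x + sum (map f xs))              ∎

  module _ {P : A → Set} (P? : Decidable P) where

    sum-map-filter : ∀ (f : A → ℕ) xs →
      sum (map f (filter P? xs)) ≡ sum (map (λ x → if does (P? x) then f x else 0) xs)
    sum-map-filter f []       = refl
    sum-map-filter f (x ∷ xs) with does (P? x)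
    ... | true  = cong (f x +_) (sum-map-filter f xs)
    ... | false = sum-map-filter f xs

    length-filter : ∀ xs → length (filter P? xs) ≡ sum (map (𝟙 ∘ does ∘ P?) xs)
    length-filter []       = refl
    length-filter (x ∷ xs) with does (P? x)
    ... | true  = cong suc (length-filter xs)
    ... | false = length-filter xs

sum-map-concatMap : ∀ {A B : Set} (f : B → ℕ) (g : A → List B) xs →
  sum (map f (concatMap g xs)) ≡ sum (map (λ x → sum (map f (g x))) xs)
sum-map-concatMap f g []       = refl
sum-map-concatMap f g (x ∷ xs) = begin
  sum (map f (g x ++ concatMap g xs))
    ≡⟨ cong sum (map-++ f (g x) _) ⟩
  sum (map f (g x) ++ map f (concatMap g xs))
    ≡⟨ sum-++ (map f (g x)) _ ⟩
  sum (map f (g x)) + sum (map f (concatMap g xs))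
    ≡⟨ cong (sum (map f (g x)) +_) (sum-map-concatMap f g xs) ⟩
  sum (map f (g x)) + sum (map (λ x → sum (map f (g x))) xs) ∎

sumWords : ∀ m → (Word m → ℕ) → ℕ
sumWords m f = sum (map f (allWords m))

sumLetters : (Fin 3 → ℕ) → ℕ
sumLetters g = sum (map g (allFin 3))

sumWords-cong : ∀ m {f g : Word m → ℕ} → (∀ w → f w ≡ g w) → sumWords m f ≡ sumWords m g
sumWords-cong m f≗g = sum-map-cong f≗g (allWords m)

sumWords-∷ : ∀ m (f : Word (suc m) → ℕ) →
  sumWords (suc m) f ≡ sumLetters (λ a → sumWords m (f ∘ (a ∷_)))
sumWords-∷ m f = trans (sum-map-concatMap f (λ a → map (a ∷_) (allWords m)) (allFin 3))
  (sum-map-cong (λ a → cong sum (sym (map-∘ {g = f} {f = a ∷_} (allWords m)))) (allFin 3))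

sumWords-𝟙-∧ : ∀ m b (p : Word m → Bool) →
  sumWords m (λ w → 𝟙 (b ∧ p w)) ≡ (if b then sumWords m (𝟙 ∘ p) else 0)
sumWords-𝟙-∧ m true  p = refl
sumWords-𝟙-∧ m false p = sum-map-zero (allWords m)

_≟ʷ_ : ∀ {m} → DecidableEquality (Word m)
_≟ʷ_ = Vec.≡-dec Fin._≟_

_≟ᵐ_ : DecidableEquality (Maybe (Fin 3))
_≟ᵐ_ = Maybe.≡-dec Fin._≟_

sumWords-≟ : ∀ {m} (u : Word m) → sumWords m (λ v → 𝟙 (does (u ≟ʷ v))) ≡ 1
sumWords-≟ []            = refl
sumWords-≟ {suc m} (a ∷ u) = begin
  sumWords (suc m) (λ v → 𝟙 (does ((a ∷ u) ≟ʷ v)))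
    ≡⟨ sumWords-∷ m _ ⟩
  sumLetters (λ b → sumWords m (λ v → 𝟙 (does (a Fin.≟ b) ∧ does (u ≟ʷ v))))
    ≡⟨ sum-map-cong (λ b → sumWords-𝟙-∧ m (does (a Fin.≟ b)) (λ v → does (u ≟ʷ v))) (allFin 3) ⟩
  sumLetters (λ b → if does (a Fin.≟ b) then sumWords m (λ v → 𝟙 (does (u ≟ʷ v))) else 0)
    ≡⟨ sum-map-cong (λ b → cong (λ k → if does (a Fin.≟ b) then k else 0) (sumWords-≟ u)) (allFin 3) ⟩
  sumLetters (λ b → 𝟙 (does (a Fin.≟ b)))
    ≡⟨ sumLetters-≟ a ⟩
  1 ∎
  where
  sumLetters-≟ : ∀ a → sumLetters (λ b → 𝟙 (does (a Fin.≟ b))) ≡ 1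
  sumLetters-≟ zero = refl
  sumLetters-≟ one  = refl
  sumLetters-≟ two  = refl

allWords-complete : ∀ {m} (w : Word m) → w ∈ allWords m
allWords-complete []      = here refl
allWords-complete (a ∷ w) =
  ∈-concatMap⁺ (λ b → map (b ∷_) (allWords _)) (lose (∈-allFin a) (∈-map⁺ (a ∷_) (allWords-complete w)))

-- The automaton

data State : Set where
  initial beforeZero afterZero : State

admits : State → Fin 3 → Bool
admits initial   two = false
admits afterZero one = false
admits _         _   = true

advance : State → Fin 3 → State
advance afterZero _    = afterZero
advance _         zero = afterZero
advance _         _    = beforeZero

accepts : ∀ {m} → State → Word m → Bool
accepts s []      = true
accepts s (a ∷ w) = admits s a ∧ accepts (advance s a) w

nextAdmitted : State → Fin 3 → Maybe (Fin 3)
nextAdmitted initial    zero = just one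
nextAdmitted beforeZero zero = just one
nextAdmitted beforeZero one  = just two
nextAdmitted afterZero  zero = just two
nextAdmitted afterZero  one  = just two
nextAdmitted _          _    = nothing

isCover : ∀ {m} → State → Word m → Word m → Bool
isCover s []      []      = false
isCover s (a ∷ u) (b ∷ v) =
  if does (a Fin.≟ b) then isCover (advance s a) u v
  else does (nextAdmitted s a ≟ᵐ just b) ∧ does (u ≟ʷ v)

coverCount : ∀ {m} → State → Word m → ℕ
coverCount s []      = 0
coverCount s (a ∷ w) = 𝟙 (is-just (nextAdmitted s a)) + coverCount (advance s a) w

sumLetters-nextAdmitted : ∀ s a c →
  sumLetters (λ b → if does (a Fin.≟ b) then c else 𝟙 (does (nextAdmitted s a ≟ᵐ just b)))
  ≡ c + 𝟙 (is-just (nextAdmitted s a))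
sumLetters-nextAdmitted initial    zero _ = refl
sumLetters-nextAdmitted initial    one  _ = refl
sumLetters-nextAdmitted initial    two  _ = refl
sumLetters-nextAdmitted beforeZero zero _ = refl
sumLetters-nextAdmitted beforeZero one  _ = refl
sumLetters-nextAdmitted beforeZero two  _ = refl
sumLetters-nextAdmitted afterZero  zero _ = refl
sumLetters-nextAdmitted afterZero  one  _ = refl
sumLetters-nextAdmitted afterZero  two  _ = refl

sumWords-isCover : ∀ {m} s (u : Word m) → sumWords m (λ v → 𝟙 (isCover s u v)) ≡ coverCount s u
sumWords-isCover s []              = refl
sumWords-isCover {suc m} s (a ∷ u) = begin
  sumWords (suc m) (λ v → 𝟙 (isCover s (a ∷ u) v))
    ≡⟨ sumWords-∷ m _ ⟩
  sumLetters (λ b → sumWords m (λ v → 𝟙 (isCover s (a ∷ u) (b ∷ v))))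
    ≡⟨ sum-map-cong letter (allFin 3) ⟩
  sumLetters (λ b → if does (a Fin.≟ b) then coverCount (advance s a) u else 𝟙 (isNext b))
    ≡⟨ sumLetters-nextAdmitted s a _ ⟩
  coverCount (advance s a) u + 𝟙 (is-just (nextAdmitted s a))
    ≡⟨ ℕ.+-comm (coverCount (advance s a) u) _ ⟩
  coverCount s (a ∷ u) ∎
  where
  isNext : Fin 3 → Bool
  isNext b = does (nextAdmitted s a ≟ᵐ just b)

  letter : ∀ b → sumWords m (λ v → 𝟙 (isCover s (a ∷ u) (b ∷ v)))
                 ≡ (if does (a Fin.≟ b) then coverCount (advance s a) u else 𝟙 (isNext b))
  letter b with does (a Fin.≟ b)
  ... | true  = sumWords-isCover (advance s a) u
  ... | false = trans (sumWords-𝟙-∧ m (isNext b) _)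
                      (cong (λ k → if isNext b then k else 0) (sumWords-≟ u))

-- Generating polynomials of the states

hPolyFrom : State → ℕ → ℕ → ℕ
hPolyFrom s m y = sumWords m (λ w → if accepts s w then y ^ coverCount s w else 0)

hPolyFrom-suc : ∀ s m y → hPolyFrom s (suc m) y ≡
  sumLetters (λ a → if admits s a then y ^ 𝟙 (is-just (nextAdmitted s a)) * hPolyFrom (advance s a) m y else 0)
hPolyFrom-suc s m y = trans (sumWords-∷ m _) (sum-map-cong letter (allFin 3))
  where
  letter : ∀ a → sumWords m (λ w → if admits s a ∧ accepts (advance s a) w
                                     then y ^ (𝟙 (is-just (nextAdmitted s a)) + coverCount (advance s a) w) else 0)
               ≡ (if admits s a then y ^ 𝟙 (is-just (nextAdmitted s a)) * hPolyFrom (advance s a) m y else 0)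
  letter a with admits s a
  ... | false = sum-map-zero (allWords m)
  ... | true  = begin
    sumWords m (λ w → if accepts s′ w then y ^ (k + coverCount s′ w) else 0)
      ≡⟨ sumWords-cong m (λ w → cong (λ t → if accepts s′ w then t else 0) (ℕ.^-distribˡ-+-* y k _)) ⟩
    sumWords m (λ w → if accepts s′ w then y ^ k * y ^ coverCount s′ w else 0)
      ≡⟨ sumWords-cong m (λ w → if-*ˡ (accepts s′ w) (y ^ k) _) ⟩
    sumWords m (λ w → y ^ k * (if accepts s′ w then y ^ coverCount s′ w else 0))
      ≡⟨ sum-map-*ˡ (y ^ k) _ (allWords m) ⟩
    y ^ k * hPolyFrom s′ m y ∎
    where
    s′ = advance s a
    k  = 𝟙 (is-just (nextAdmitted s a))

hPolyFrom-afterZero-suc : ∀ m y → hPolyFrom afterZero (suc m) y ≡ (y + 1) * hPolyFrom afterZero m y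
hPolyFrom-afterZero-suc m y = trans (hPolyFrom-suc afterZero m y) (algebra y (hPolyFrom afterZero m y))
  where
  algebra : ∀ y A → y * 1 * A + (0 + (1 * A + 0)) ≡ (y + 1) * A
  algebra = solve-∀

hPolyFrom-beforeZero-suc : ∀ m y →
  hPolyFrom beforeZero (suc m) y ≡ y * hPolyFrom afterZero m y + (y + 1) * hPolyFrom beforeZero m y
hPolyFrom-beforeZero-suc m y =
  trans (hPolyFrom-suc beforeZero m y) (algebra y (hPolyFrom afterZero m y) (hPolyFrom beforeZero m y))
  where
  algebra : ∀ y A B → y * 1 * A + (y * 1 * B + (1 * B + 0)) ≡ y * A + (y + 1) * B
  algebra = solve-∀

hPolyFrom-initial-suc : ∀ m y →
  hPolyFrom initial (suc m) y ≡ y * hPolyFrom afterZero m y + hPolyFrom beforeZero m y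
hPolyFrom-initial-suc m y =
  trans (hPolyFrom-suc initial m y) (algebra y (hPolyFrom afterZero m y) (hPolyFrom beforeZero m y))
  where
  algebra : ∀ y A B → y * 1 * A + (1 * B + 0) ≡ y * A + B
  algebra = solve-∀

hPolyFrom-afterZero : ∀ m y → hPolyFrom afterZero m y ≡ (y + 1) ^ m
hPolyFrom-afterZero zero    y = refl
hPolyFrom-afterZero (suc m) y =
  trans (hPolyFrom-afterZero-suc m y) (cong ((y + 1) *_) (hPolyFrom-afterZero m y))

hPolyFrom-beforeZero : ∀ k y → hPolyFrom beforeZero (suc k) y ≡ (y + 1) ^ k * (y + 1 + suc k * y)
hPolyFrom-beforeZero zero    y = trans (hPolyFrom-beforeZero-suc 0 y) (algebra y)
  where
  algebra : ∀ y → y * 1 + (y + 1) * 1 ≡ 1 * (y + 1 + 1 * y)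
  algebra = solve-∀
hPolyFrom-beforeZero (suc k) y = begin
  hPolyFrom beforeZero (suc (suc k)) y
    ≡⟨ hPolyFrom-beforeZero-suc (suc k) y ⟩
  y * hPolyFrom afterZero (suc k) y + (y + 1) * hPolyFrom beforeZero (suc k) y
    ≡⟨ cong₂ (λ A B → y * A + (y + 1) * B) (hPolyFrom-afterZero (suc k) y) (hPolyFrom-beforeZero k y) ⟩
  y * ((y + 1) * (y + 1) ^ k) + (y + 1) * ((y + 1) ^ k * (y + 1 + suc k * y))
    ≡⟨ algebra y ((y + 1) ^ k) k ⟩
  (y + 1) ^ suc k * (y + 1 + suc (suc k) * y) ∎
  where
  algebra : ∀ y P k → y * ((y + 1) * P) + (y + 1) * (P * (y + 1 + (1 + k) * y))
                      ≡ (y + 1) * P * (y + 1 + (2 + k) * y)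
  algebra = solve-∀

hPolyFrom-initial : ∀ n y → hPolyFrom initial (suc n) y ≡ rhs n y
hPolyFrom-initial zero    y = trans (hPolyFrom-initial-suc 0 y) (algebra y)
  where
  algebra : ∀ y → y * 1 + 1 ≡ y + 1
  algebra = solve-∀
hPolyFrom-initial (suc k) y = begin
  hPolyFrom initial (suc (suc k)) y
    ≡⟨ hPolyFrom-initial-suc (suc k) y ⟩
  y * hPolyFrom afterZero (suc k) y + hPolyFrom beforeZero (suc k) y
    ≡⟨ cong₂ (λ A B → y * A + B) (hPolyFrom-afterZero (suc k) y) (hPolyFrom-beforeZero k y) ⟩
  y * ((y + 1) * (y + 1) ^ k) + (y + 1) ^ k * (y + 1 + suc k * y)
    ≡⟨ algebra y ((y + 1) ^ k) k ⟩
  rhs (suc k) y ∎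
  where
  algebra : ∀ y P k → y * ((y + 1) * P) + P * (y + 1 + (1 + k) * y)
                      ≡ P * (y * y + (2 + k + 1) * y + 1)
  algebra = solve-∀

-- Acceptance is membership in Tr(n)

accepts-∷⁻ : ∀ {m} s a (w : Word m) →
  T (accepts s (a ∷ w)) → T (admits s a) × T (accepts (advance s a) w)
accepts-∷⁻ s a w = Equivalence.to T-∧

accepts-∷⁺ : ∀ {m} s a (w : Word m) →
  T (admits s a) → T (accepts (advance s a) w) → T (accepts s (a ∷ w))
accepts-∷⁺ s a w p q = Equivalence.from T-∧ (p , q)

afterZero⊆beforeZero : ∀ {m} (w : Word m) → T (accepts afterZero w) → T (accepts beforeZero w)
afterZero⊆beforeZero []         _   = tt
afterZero⊆beforeZero (zero ∷ w) acc = acc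
afterZero⊆beforeZero (two  ∷ w) acc = afterZero⊆beforeZero w acc

advance-mono : ∀ {m} s {a b} (w : Word m) →
  a ≤ᶠ b → T (accepts (advance s a) w) → T (accepts (advance s b) w)
advance-mono afterZero                  _ _ acc = acc
advance-mono initial    {zero}  {zero}  _ _ acc = acc
advance-mono initial    {zero}  {suc _} w _ acc = afterZero⊆beforeZero w acc
advance-mono initial    {suc _} {suc _} _ _ acc = acc
advance-mono beforeZero {zero}  {zero}  _ _ acc = acc
advance-mono beforeZero {zero}  {suc _} w _ acc = afterZero⊆beforeZero w acc
advance-mono beforeZero {suc _} {suc _} _ _ acc = acc

NoOne : ∀ {m} → Word m → Set
NoOne {m} w = ∀ (j : Fin m) → lookup w j ≢ one

Avoids01 : ∀ {m} → Word m → Set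
Avoids01 {m} w = ∀ (i j : Fin m) → i <ᶠ j → lookup w i ≡ zero → lookup w j ≡ one → ⊥

accepts-afterZero⇔NoOne : ∀ {m} (w : Word m) → T (accepts afterZero w) ⇔ NoOne w
accepts-afterZero⇔NoOne w = mk⇔ (to w) (from w)
  where
  to : ∀ {m} (w : Word m) → T (accepts afterZero w) → NoOne w
  to (zero ∷ w) acc zero    ()
  to (two  ∷ w) acc zero    ()
  to (zero ∷ w) acc (suc j) = to w acc j
  to (two  ∷ w) acc (suc j) = to w acc j

  from : ∀ {m} (w : Word m) → NoOne w → T (accepts afterZero w)
  from []         _  = tt
  from (zero ∷ w) ≢1 = from w (≢1 ∘ suc)
  from (one  ∷ w) ≢1 = ≢1 zero refl
  from (two  ∷ w) ≢1 = from w (≢1 ∘ suc)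

accepts-beforeZero⇔Avoids01 : ∀ {m} (w : Word m) → T (accepts beforeZero w) ⇔ Avoids01 w
accepts-beforeZero⇔Avoids01 w = mk⇔ (to w) (from w)
  where
  to : ∀ {m} (w : Word m) → T (accepts beforeZero w) → Avoids01 w
  to (zero ∷ w) acc zero    (suc j) _         _  wⱼ≡1 =
    Equivalence.to (accepts-afterZero⇔NoOne w) acc j wⱼ≡1
  to (zero ∷ w) acc (suc i) (suc j) (s≤s i<j)        = to w (afterZero⊆beforeZero w acc) i j i<j
  to (one  ∷ w) acc (suc i) (suc j) (s≤s i<j)        = to w acc i j i<j
  to (two  ∷ w) acc (suc i) (suc j) (s≤s i<j)        = to w acc i j i<j

  from : ∀ {m} (w : Word m) → Avoids01 w → T (accepts beforeZero w)
  from []         _   = tt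
  from (zero ∷ w) ¬01 =
    Equivalence.from (accepts-afterZero⇔NoOne w) (λ j → ¬01 zero (suc j) (s≤s z≤n) refl)
  from (one  ∷ w) ¬01 = from w (λ i j i<j → ¬01 (suc i) (suc j) (s≤s i<j))
  from (two  ∷ w) ¬01 = from w (λ i j i<j → ¬01 (suc i) (suc j) (s≤s i<j))

accepts-initial⇔IsTr : ∀ {n} (u : Word (suc n)) → T (accepts initial u) ⇔ IsTr u
accepts-initial⇔IsTr u = mk⇔ (to u) (from u)
  where
  to : ∀ {n} (u : Word (suc n)) → T (accepts initial u) → IsTr u
  to (zero ∷ w) acc = (λ ()) , Equivalence.to (accepts-beforeZero⇔Avoids01 (zero ∷ w)) acc
  to (one  ∷ w) acc = (λ ()) , Equivalence.to (accepts-beforeZero⇔Avoids01 (one ∷ w)) acc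
  to (two  ∷ w) ()

  from : ∀ {n} (u : Word (suc n)) → IsTr u → T (accepts initial u)
  from (zero ∷ w) (_   , ¬01) = Equivalence.from (accepts-beforeZero⇔Avoids01 (zero ∷ w)) ¬01
  from (one  ∷ w) (_   , ¬01) = Equivalence.from (accepts-beforeZero⇔Avoids01 (one ∷ w)) ¬01
  from (two  ∷ w) (≢2 , _)   = ≢2 refl

IsTr⇒accepts : ∀ {n} (u : Word (suc n)) → IsTr u → T (accepts initial u)
IsTr⇒accepts u = Equivalence.from (accepts-initial⇔IsTr u)

accepts⇒IsTr : ∀ {n} (u : Word (suc n)) → T (accepts initial u) → IsTr u
accepts⇒IsTr u = Equivalence.to (accepts-initial⇔IsTr u)

-- Covers

≼-refl : ∀ {m} (u : Word m) → u ≼ u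
≼-refl u _ = Fin.≤-refl

≼-∷ : ∀ {m a b} {u v : Word m} → a ≤ᶠ b → u ≼ v → (a ∷ u) ≼ (b ∷ v)
≼-∷ a≤b u≼v zero    = a≤b
≼-∷ a≤b u≼v (suc i) = u≼v i

≼-antisym : ∀ {m} {u v : Word m} → u ≼ v → v ≼ u → u ≡ v
≼-antisym {u = []}    {[]}    _   _   = refl
≼-antisym {u = a ∷ u} {b ∷ v} u≼v v≼u =
  cong₂ _∷_ (Fin.≤-antisym (u≼v zero) (v≼u zero)) (≼-antisym (u≼v ∘ suc) (v≼u ∘ suc))

record IsNextAdmitted (s : State) (a b : Fin 3) : Set where
  field
    above    : a <ᶠ b
    admitted : T (admits s b)
    least    : ∀ {d} → T (admits s d) → a <ᶠ d → b ≤ᶠ d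

open IsNextAdmitted

nextAdmitted-spec : ∀ s a {b} → nextAdmitted s a ≡ just b → IsNextAdmitted s a b
nextAdmitted-spec initial    zero refl = record { above = s≤s z≤n ; admitted = tt ; least = λ _ a<d → a<d }
nextAdmitted-spec beforeZero zero refl = record { above = s≤s z≤n ; admitted = tt ; least = λ _ a<d → a<d }
nextAdmitted-spec beforeZero one  refl = record { above = s≤s (s≤s z≤n) ; admitted = tt ; least = λ _ a<d → a<d }
nextAdmitted-spec afterZero  zero refl =
  record { above = s≤s z≤n ; admitted = tt ; least = λ { {two} _ _ → ℕ.≤-refl } }
nextAdmitted-spec afterZero  one  refl = record { above = s≤s (s≤s z≤n) ; admitted = tt ; least = λ _ a<d → a<d }
nextAdmitted-spec initial    one  ()
nextAdmitted-spec initial    two  ()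
nextAdmitted-spec beforeZero two  ()
nextAdmitted-spec afterZero  two  ()

nextAdmitted-defined : ∀ s a {b} → T (admits s b) → a <ᶠ b → ∃[ c ] nextAdmitted s a ≡ just c
nextAdmitted-defined initial    zero _ _ = one , refl
nextAdmitted-defined beforeZero zero _ _ = one , refl
nextAdmitted-defined beforeZero one  _ _ = two , refl
nextAdmitted-defined afterZero  zero _ _ = two , refl
nextAdmitted-defined afterZero  one  _ _ = two , refl
nextAdmitted-defined initial    one  {one} _  (s≤s ())
nextAdmitted-defined initial    one  {two} () _
nextAdmitted-defined _          two  {b} _ two<b = contradiction (Fin.≤fromℕ b) (ℕ.<⇒≱ two<b)

nextAdmitted-squeeze : ∀ s a {b d} → nextAdmitted s a ≡ just b → T (admits s d) → a ≤ᶠ d → d ≤ᶠ b →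
  d ≡ a ⊎ d ≡ b
nextAdmitted-squeeze s a {d = d} r adm a≤d d≤b with a Fin.≟ d
... | yes a≡d = inj₁ (sym a≡d)
... | no  a≢d = inj₂ (Fin.≤-antisym d≤b (least (nextAdmitted-spec s a r) adm (Fin.≤∧≢⇒< a≤d a≢d)))

nextAdmitted-or-skip : ∀ s a {b} → T (admits s b) → a <ᶠ b →
  nextAdmitted s a ≡ just b ⊎ ∃[ c ] T (admits s c) × a <ᶠ c × c <ᶠ b
nextAdmitted-or-skip s a {b} adm a<b with nextAdmitted-defined s a adm a<b
... | c , r with c Fin.≟ b
...   | yes refl = inj₁ r
...   | no  c≢b  = let next = nextAdmitted-spec s a r in
                   inj₂ (c , admitted next , above next , Fin.≤∧≢⇒< (least next adm a<b) c≢b)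

isCover-∷⁻ : ∀ {m} s a b (u v : Word m) → T (isCover s (a ∷ u) (b ∷ v)) →
  (a ≡ b × T (isCover (advance s a) u v)) ⊎ (nextAdmitted s a ≡ just b × u ≡ v)
isCover-∷⁻ s a b u v c with a Fin.≟ b
... | yes refl = inj₁ (refl , c)
... | no  _    = let r , e = Equivalence.to T-∧ c in
                 inj₂ (does-sound (nextAdmitted s a ≟ᵐ just b) r , does-sound (u ≟ʷ v) e)

isCover⇒accepts : ∀ {m} s (u v : Word m) → T (accepts s u) → T (isCover s u v) → T (accepts s v)
isCover⇒accepts s []      []      _   ()
isCover⇒accepts s (a ∷ u) (b ∷ v) acc c with accepts-∷⁻ s a u acc | isCover-∷⁻ s a b u v c
... | adm , acc′ | inj₁ (refl , c′) = accepts-∷⁺ s a v adm (isCover⇒accepts (advance s a) u v acc′ c′)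
... | _   , acc′ | inj₂ (r , refl)  = let next = nextAdmitted-spec s a r in
                                      accepts-∷⁺ s b u (admitted next)
                                        (advance-mono s u (ℕ.<⇒≤ (above next)) acc′)

isCover⇒≺ : ∀ {m} s (u v : Word m) → T (isCover s u v) → u ≺ v
isCover⇒≺ s []      []      ()
isCover⇒≺ s (a ∷ u) (b ∷ v) c with isCover-∷⁻ s a b u v c
... | inj₁ (refl , c′) = let u≼v , u≢v = isCover⇒≺ (advance s a) u v c′ in
                         ≼-∷ ℕ.≤-refl u≼v , u≢v ∘ Vec.∷-injectiveʳ
... | inj₂ (r , refl)  = let a<b = above (nextAdmitted-spec s a r) in
                         ≼-∷ (ℕ.<⇒≤ a<b) (≼-refl u) , Fin.<⇒≢ a<b ∘ Vec.∷-injectiveˡ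

isCover-squeeze : ∀ {m} s (u v w : Word m) → T (isCover s u v) → T (accepts s w) → u ≼ w → w ≼ v →
  w ≡ u ⊎ w ≡ v
isCover-squeeze s []      []      []      ()
isCover-squeeze s (a ∷ u) (b ∷ v) (d ∷ w) c acc u≼w w≼v with isCover-∷⁻ s a b u v c
... | inj₁ (refl , c′) with Fin.≤-antisym (w≼v zero) (u≼w zero)
...   | refl = Sum.map (cong (d ∷_)) (cong (d ∷_))
                 (isCover-squeeze (advance s d) u v w c′ (proj₂ (accepts-∷⁻ s d w acc))
                   (u≼w ∘ suc) (w≼v ∘ suc))
isCover-squeeze s (a ∷ u) (b ∷ v) (d ∷ w) c acc u≼w w≼v | inj₂ (r , refl)
  with ≼-antisym {u = w} {v = u} (w≼v ∘ suc) (u≼w ∘ suc)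
...   | refl = Sum.map (cong (_∷ w)) (cong (_∷ w))
                 (nextAdmitted-squeeze s a r (proj₁ (accepts-∷⁻ s d w acc)) (u≼w zero) (w≼v zero))

Between : ∀ {m} → State → Word m → Word m → Set
Between s u v = ∃[ w ] T (accepts s w) × u ≺ w × w ≺ v

between-∷ : ∀ {m} s a {u v : Word m} →
  T (admits s a) → Between (advance s a) u v → Between s (a ∷ u) (a ∷ v)
between-∷ s a adm (w , acc , (u≼w , u≢w) , (w≼v , w≢v)) =
  a ∷ w , accepts-∷⁺ s a w adm acc ,
  (≼-∷ ℕ.≤-refl u≼w , u≢w ∘ Vec.∷-injectiveʳ) , (≼-∷ ℕ.≤-refl w≼v , w≢v ∘ Vec.∷-injectiveʳ)

between-head : ∀ {m} s {a b c} (u v : Word m) → T (admits s c) → T (accepts (advance s a) u) →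
  a <ᶠ c → c ≤ᶠ b → u ≼ v → (c ≡ b → u ≢ v) → Between s (a ∷ u) (b ∷ v)
between-head s {c = c} u v adm acc a<c c≤b u≼v c≡b⇒u≢v =
  c ∷ u , accepts-∷⁺ s c u adm (advance-mono s u (ℕ.<⇒≤ a<c) acc) ,
  (≼-∷ (ℕ.<⇒≤ a<c) (≼-refl u) , Fin.<⇒≢ a<c ∘ Vec.∷-injectiveˡ) ,
  (≼-∷ c≤b u≼v , λ eq → c≡b⇒u≢v (Vec.∷-injectiveˡ eq) (Vec.∷-injectiveʳ eq))

≺⇒isCover⊎between : ∀ {m} s (u v : Word m) → T (accepts s u) → T (accepts s v) → u ≺ v →
  T (isCover s u v) ⊎ Between s u v
≺⇒isCover⊎between s []      []      _    _    (_ , u≢v)   = contradiction refl u≢v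
≺⇒isCover⊎between s (a ∷ u) (b ∷ v) accu accv (u≼v , u≢v)
  with accepts-∷⁻ s a u accu | accepts-∷⁻ s b v accv | a Fin.≟ b
... | adm , accu′ | _ , accv′ | yes refl =
  Sum.map₂ (between-∷ s a adm)
    (≺⇒isCover⊎between (advance s a) u v accu′ accv′ (u≼v ∘ suc , u≢v ∘ cong (a ∷_)))
... | _ , accu′ | admb , _ | no a≢b with u ≟ʷ v
...   | no u≢v′  = inj₂ (between-head s u v admb accu′ a<b ℕ.≤-refl (u≼v ∘ suc) (λ _ → u≢v′))
  where a<b = Fin.≤∧≢⇒< (u≼v zero) a≢b
...   | yes refl =
  [ (λ r → inj₁ (Equivalence.from T-∧ (does-complete (nextAdmitted s a ≟ᵐ just b) r , tt)))
  , (λ (c , admc , a<c , c<b) → inj₂ (between-head s u u admc accu′ a<c (ℕ.<⇒≤ c<b) (≼-refl u)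
                                       (λ c≡b → contradiction c≡b (Fin.<⇒≢ c<b))))
  ]′ (nextAdmitted-or-skip s a admb a<b)
  where a<b = Fin.≤∧≢⇒< (u≼v zero) a≢b

Any-Tr⁻ : ∀ {n} {P : Word (suc n) → Set} → Any P (Tr n) → ∃[ w ] IsTr w × P w
Any-Tr⁻ {n} any =
  let w , w∈Tr , Pw = find any in w , proj₂ (∈-filter⁻ isTr? {xs = allWords (suc n)} w∈Tr) , Pw

Any-Tr⁺ : ∀ {n} {P : Word (suc n) → Set} (w : Word (suc n)) → IsTr w → P w → Any P (Tr n)
Any-Tr⁺ w trw = lose (∈-filter⁺ isTr? (allWords-complete w) trw)

isCover-initial⇔Covers : ∀ n (u v : Word (suc n)) → IsTr u →
  T (isCover initial u v) ⇔ (IsTr v × Covers n u v)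
isCover-initial⇔Covers n u v tru = mk⇔ to from
  where
  accu : T (accepts initial u)
  accu = IsTr⇒accepts u tru

  to : T (isCover initial u v) → IsTr v × Covers n u v
  to c = accepts⇒IsTr v (isCover⇒accepts initial u v accu c) , isCover⇒≺ initial u v c ,
    λ any →
      let w , trw , (u≼w , u≢w) , (w≼v , w≢v) = Any-Tr⁻ any in
      [ u≢w ∘ sym , w≢v ]′ (isCover-squeeze initial u v w c (IsTr⇒accepts w trw) u≼w w≼v)

  from : IsTr v × Covers n u v → T (isCover initial u v)
  from (trv , u≺v , ∄between) =
    fromInj₁ (λ (w , accw , between) → contradiction (Any-Tr⁺ w (accepts⇒IsTr w accw) between) ∄between)
      (≺⇒isCover⊎between initial u v accu (IsTr⇒accepts v trv) u≺v)

out≡coverCount : ∀ n (u : Word (suc n)) → IsTr u → out n u ≡ coverCount initial u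
out≡coverCount n u tru = begin
  out n u
    ≡⟨ length-filter (covers? n u) (Tr n) ⟩
  sum (map (𝟙 ∘ does ∘ covers? n u) (Tr n))
    ≡⟨ sum-map-filter isTr? (𝟙 ∘ does ∘ covers? n u) (allWords (suc n)) ⟩
  sumWords (suc n) (λ v → if does (isTr? v) then 𝟙 (does (covers? n u v)) else 0)
    ≡⟨ sumWords-cong (suc n) (λ v → trans (if-𝟙 (does (isTr? v)) _)
         (cong 𝟙 (sym (does-⇔ (isCover-initial⇔Covers n u v tru) (T? _) (isTr? v ×-dec covers? n u v))))) ⟩
  sumWords (suc n) (λ v → 𝟙 (isCover initial u v))
    ≡⟨ sumWords-isCover initial u ⟩
  coverCount initial u ∎

proposition3p3 : (n : ℕ) → (y : ℕ) → hPoly n y ≡ rhs n y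
proposition3p3 n y = begin
  hPoly n y
    ≡⟨ sum-map-filter isTr? (λ u → y ^ out n u) (allWords (suc n)) ⟩
  sumWords (suc n) (λ u → if does (isTr? u) then y ^ out n u else 0)
    ≡⟨ sumWords-cong (suc n) term ⟩
  hPolyFrom initial (suc n) y
    ≡⟨ hPolyFrom-initial n y ⟩
  rhs n y ∎
  where
  term : ∀ u → (if does (isTr? u) then y ^ out n u else 0)
             ≡ (if accepts initial u then y ^ coverCount initial u else 0)
  term u = begin
    (if does (isTr? u) then y ^ out n u else 0)
      ≡⟨ cong (λ b → if b then y ^ out n u else 0)
              (sym (does-⇔ (accepts-initial⇔IsTr u) (T? _) (isTr? u))) ⟩
    (if accepts initial u then y ^ out n u else 0)
      ≡⟨ if-T-cong (accepts initial u) (cong (y ^_) ∘ out≡coverCount n u ∘ accepts⇒IsTr u) ⟩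
    (if accepts initial u then y ^ coverCount initial u else 0) ∎
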